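{- Let $\mathbf{L}=\langle L,\leq,\otimes,\rightarrow,0,1\rangle$ be a complete residuated lattice, let $Y\neq\emptyset$, and let ${}^*$ be an idempotent truth-stressing hedge on $\mathbf{L}$. An operator $C\colon L^Y\to L^Y$ is an $\mathbf{L}^*$-closure operator if and only if it is an $\mathbf{L}_{\{1\}}$-closure operator and $$C(a^*\rightarrow C(A))\subseteq a^*\rightarrow C(A)$$ holds for all $a\in L$ and all $A\in L^Y$.
   Context: A complete (commutative integral) residuated lattice $\mathbf{L}=\langle L,\leq,\otimes,\rightarrow,0,1\rangle$: $\langle L,\leq\rangle$ is a complete lattice with least element $0$ and greatest element $1$, $\otimes$ is associative, commutative with neutral element $1$, and $a\otimes b\leq c$ iff $b\leq a\rightarrow c$ for all $a,b,c\in L$. $L^Y$ is the set of all maps $A\colon Y\to L$ ($\mathbf{L}$-sets in $Y$); $A\subseteq B$ means $A(y)\leq B(y)$ for all $y\in Y$. For $a\in L$ and $A\in L^Y$, $a\rightarrow A$ is the $\mathbf{L}$-set $(a\rightarrow A)(y)=a\rightarrow A(y)$. The subsethood degree is $S(A,B)=\bigwedge_{y\in Y}(A(y)\rightarrow B(y))$. An idempotent truth-stressing hedge is a map ${}^*\colon L\to L$ with $1^*=1$, $a^*\leq a$, $(a\rightarrow b)^*\leq a^*\rightarrow b^*$ and $a^{**}=a^*$ for all $a,b\in L$. An $\mathbf{L}^*$-closure operator is $C\colon L^Y\to L^Y$ with $A\subseteq C(A)$, $S(A,B)^*\leq S(C(A),C(B))$, and $C(C(A))\subseteq C(A)$ for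 all $A,B\in L^Y$. An $\mathbf{L}_{\{1\}}$-closure operator is an ordinary closure operator on $\langle L^Y,\subseteq\rangle$: $A\subseteq C(A)$, $A\subseteq B$ implies $C(A)\subseteq C(B)$, and $C(C(A))\subseteq C(A)$. -}

module Defs where

open import Level using (0ℓ)
open import Relation.Binary.PropositionalEquality using (_≡_)
open import Relation.Binary.Structures using (IsPartialOrder)
open import Data.Product using (_×_)

-- Complete (commutative integral) residuated lattice
-- ⟨ L , ≤ , ⊗ , → , 0 , 1 ⟩ ; completeness is expressed by arbitrary
-- infima ⋀ of families indexed by any (small) type (hence also all suprema).
record CompleteResiduatedLattice : Set₁ where
  infixr 5 _⇒_
  infixl 7 _⊗_
  infix 4 _≤_
  field
    Carrier   : Set
    _≤_       : Carrier → Carrier → Set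
    isPartialOrder : IsPartialOrder _≡_ _≤_
    ⋀         : {I : Set} → (I → Carrier) → Carrier
    ⋀-lower   : {I : Set} (f : I → Carrier) (i : I) → ⋀ f ≤ f i
    ⋀-greatest : {I : Set} (f : I → Carrier) (a : Carrier) →
                 ((i : I) → a ≤ f i) → a ≤ ⋀ f
    𝟘         : Carrier
    𝟙         : Carrier
    𝟘-least   : (a : Carrier) → 𝟘 ≤ a
    𝟙-greatest : (a : Carrier) → a ≤ 𝟙
    _⊗_       : Carrier → Carrier → Carrier
    _⇒_       : Carrier → Carrier → Carrier
    ⊗-assoc   : (a b c : Carrier) → (a ⊗ b) ⊗ c ≡ a ⊗ (b ⊗ c)
    ⊗-comm    : (a b : Carrier) → a ⊗ b ≡ b ⊗ a
    ⊗-identityˡ : (a : Carrier) → 𝟙 ⊗ a ≡ a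
    residuation₁ : (a b c : Carrier) → a ⊗ b ≤ c → b ≤ a ⇒ c
    residuation₂ : (a b c : Carrier) → b ≤ a ⇒ c → a ⊗ b ≤ c

module _ (𝐋 : CompleteResiduatedLattice) where
  open CompleteResiduatedLattice 𝐋

  record IsIdempotentHedge (_* : Carrier → Carrier) : Set where
    field
      𝟙*     : 𝟙 * ≡ 𝟙
      *-≤    : (a : Carrier) → a * ≤ a
      *-⇒    : (a b : Carrier) → (a ⇒ b) * ≤ (a *) ⇒ (b *)
      *-idem : (a : Carrier) → (a *) * ≡ a *

  module _ (Y : Set) where
    LSet : Set
    LSet = Y → Carrier

    _⊆_ : LSet → LSet → Set
    A ⊆ B = (y : Y) → A y ≤ B y

    _⇒ˢ_ : Carrier → LSet → LSet
    (a ⇒ˢ A) y = a ⇒ A y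

    S : LSet → LSet → Carrier
    S A B = ⋀ (λ y → A y ⇒ B y)

    IsLStarClosure : (Carrier → Carrier) → (LSet → LSet) → Set
    IsLStarClosure _* C =
      ((A : LSet) → A ⊆ C A) ×
      ((A B : LSet) → (S A B) * ≤ S (C A) (C B)) ×
      ((A : LSet) → C (C A) ⊆ C A)

    IsL1Closure : (LSet → LSet) → Set
    IsL1Closure C =
      ((A : LSet) → A ⊆ C A) ×
      ((A B : LSet) → A ⊆ B → C A ⊆ C B) ×
      ((A : LSet) → C (C A) ⊆ C A)

-- A degree a ≤ S(A, B) says exactly that A ⊆ a → B, and since a** = a*, hedged degrees
-- are preserved by the hedge. In this reading the axiom S(A, B)* ≤ S(C(A), C(B)) splits
-- into monotonicity of C (the case a* = 1) and the stated inequality: from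
-- A ⊆ a* → C(B), monotonicity gives C(A) ⊆ C(a* → C(B)) ⊆ a* → C(B). Conversely, the
-- inequality is the axiom applied to a* → C(A) ⊆ a* → C(A), followed by idempotence of C.
module Submission where

open import Defs
open import Data.Product using (_×_; _,_)
open import Function.Bundles using (_⇔_; mk⇔; Equivalence)
open import Relation.Binary.PropositionalEquality as ≡ using (_≡_)
open import Relation.Binary.Structures using (IsPartialOrder)
open CompleteResiduatedLattice using (Carrier)
open Equivalence using (to; from)

module ResiduatedLatticeProperties (𝐋 : CompleteResiduatedLattice) where
  open CompleteResiduatedLattice 𝐋 hiding (Carrier)
  open IsPartialOrder isPartialOrder public
    using (refl; reflexive; trans; antisym; ≤-respˡ-≈)

  ⊗-identityʳ : ∀ a → a ⊗ 𝟙 ≡ a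
  ⊗-identityʳ a = ≡.trans (⊗-comm a 𝟙) (⊗-identityˡ a)

  ≤⇒-exchange : ∀ {a b c} → a ≤ b ⇒ c → b ≤ a ⇒ c
  ≤⇒-exchange {a} {b} {c} a≤b⇒c =
    residuation₁ a b c (≤-respˡ-≈ (⊗-comm b a) (residuation₂ b a c a≤b⇒c))

  ⇒-monoʳ : ∀ a {b c} → b ≤ c → a ⇒ b ≤ a ⇒ c
  ⇒-monoʳ a {b} {c} b≤c = residuation₁ a (a ⇒ b) c (trans (residuation₂ a _ b refl) b≤c)

  𝟙≤⇒⇔≤ : ∀ {a b} → 𝟙 ≤ a ⇒ b ⇔ a ≤ b
  𝟙≤⇒⇔≤ {a} {b} = mk⇔
    (λ 𝟙≤a⇒b → ≤-respˡ-≈ (⊗-identityʳ a) (residuation₂ a 𝟙 b 𝟙≤a⇒b))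
    (λ a≤b → residuation₁ a 𝟙 b (≤-respˡ-≈ (≡.sym (⊗-identityʳ a)) a≤b))

module HedgeProperties
  (𝐋 : CompleteResiduatedLattice) {_* : Carrier 𝐋 → Carrier 𝐋}
  (hedge : IsIdempotentHedge 𝐋 _*) where
  open CompleteResiduatedLattice 𝐋 hiding (Carrier)
  open ResiduatedLatticeProperties 𝐋
  open IsIdempotentHedge hedge

  *-mono : ∀ {a b} → a ≤ b → a * ≤ b *
  *-mono {a} {b} a≤b = to 𝟙≤⇒⇔≤ (trans 𝟙≤[a⇒b]* (*-⇒ a b))
    where
    𝟙≡a⇒b : 𝟙 ≡ a ⇒ b
    𝟙≡a⇒b = antisym (from 𝟙≤⇒⇔≤ a≤b) (𝟙-greatest _)
    𝟙≤[a⇒b]* : 𝟙 ≤ (a ⇒ b) *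
    𝟙≤[a⇒b]* = reflexive (≡.trans (≡.sym 𝟙*) (≡.cong _* 𝟙≡a⇒b))

module SubsethoodProperties (𝐋 : CompleteResiduatedLattice) (Y : Set) where
  open CompleteResiduatedLattice 𝐋 hiding (Carrier)
  open ResiduatedLatticeProperties 𝐋

  infix 4 _⊆ʸ_
  infixr 5 _⇒ʸ_

  _⊆ʸ_ : LSet 𝐋 Y → LSet 𝐋 Y → Set
  _⊆ʸ_ = _⊆_ 𝐋 Y

  _⇒ʸ_ : Carrier 𝐋 → LSet 𝐋 Y → LSet 𝐋 Y
  _⇒ʸ_ = _⇒ˢ_ 𝐋 Y

  ⊆-trans : ∀ {A B D} → A ⊆ʸ B → B ⊆ʸ D → A ⊆ʸ D
  ⊆-trans A⊆B B⊆D y = trans (A⊆B y) (B⊆D y)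

  ⇒ʸ-monoʳ : ∀ a {A B} → A ⊆ʸ B → a ⇒ʸ A ⊆ʸ a ⇒ʸ B
  ⇒ʸ-monoʳ a A⊆B y = ⇒-monoʳ a (A⊆B y)

  ≤S⇔⊆⇒ʸ : ∀ {a A B} → a ≤ S 𝐋 Y A B ⇔ A ⊆ʸ a ⇒ʸ B
  ≤S⇔⊆⇒ʸ {a} {A} {B} = mk⇔
    (λ a≤S y → ≤⇒-exchange (trans a≤S (⋀-lower _ y)))
    (λ A⊆a⇒B → ⋀-greatest _ a (λ y → ≤⇒-exchange (A⊆a⇒B y)))

  𝟙≤S⇔⊆ : ∀ {A B} → 𝟙 ≤ S 𝐋 Y A B ⇔ A ⊆ʸ B
  𝟙≤S⇔⊆ = mk⇔
    (λ 𝟙≤S y → to 𝟙≤⇒⇔≤ (trans 𝟙≤S (⋀-lower _ y)))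
    (λ A⊆B → ⋀-greatest _ 𝟙 (λ y → from 𝟙≤⇒⇔≤ (A⊆B y)))

  ≤S-⇒ʸ : ∀ a B → a ≤ S 𝐋 Y (a ⇒ʸ B) B
  ≤S-⇒ʸ a B = from ≤S⇔⊆⇒ʸ (λ y → refl)

module ClosureOperators
  (𝐋 : CompleteResiduatedLattice) (Y : Set) {_* : Carrier 𝐋 → Carrier 𝐋}
  (hedge : IsIdempotentHedge 𝐋 _*) (C : LSet 𝐋 Y → LSet 𝐋 Y) where
  open CompleteResiduatedLattice 𝐋 hiding (Carrier)
  open ResiduatedLatticeProperties 𝐋
  open HedgeProperties 𝐋 hedge
  open SubsethoodProperties 𝐋 Y
  open IsIdempotentHedge hedge

  HedgedMonotone : Set
  HedgedMonotone = ∀ A B → (S 𝐋 Y A B) * ≤ S 𝐋 Y (C A) (C B)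

  Monotone : Set
  Monotone = ∀ A B → A ⊆ʸ B → C A ⊆ʸ C B

  Extensive : Set
  Extensive = ∀ A → A ⊆ʸ C A

  Idempotent : Set
  Idempotent = ∀ A → C (C A) ⊆ʸ C A

  ClosedUnderHedgedShift : Set
  ClosedUnderHedgedShift = ∀ a A → C (a * ⇒ʸ C A) ⊆ʸ a * ⇒ʸ C A

  hedged-≤S : HedgedMonotone → ∀ a {A B} → a * ≤ S 𝐋 Y A B → a * ≤ S 𝐋 Y (C A) (C B)
  hedged-≤S S*-mono a {A} {B} a*≤S =
    trans (≤-respˡ-≈ (*-idem a) (*-mono a*≤S)) (S*-mono A B)

  hedgedMonotone⇒monotone : HedgedMonotone → Monotone
  hedgedMonotone⇒monotone S*-mono A B A⊆B = to 𝟙≤S⇔⊆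
    (≤-respˡ-≈ 𝟙* (hedged-≤S S*-mono 𝟙 (≤-respˡ-≈ (≡.sym 𝟙*) (from 𝟙≤S⇔⊆ A⊆B))))

  hedgedMonotone⇒closedUnderHedgedShift :
    HedgedMonotone → Idempotent → ClosedUnderHedgedShift
  hedgedMonotone⇒closedUnderHedgedShift S*-mono idem a A =
    ⊆-trans (to ≤S⇔⊆⇒ʸ (hedged-≤S S*-mono a (≤S-⇒ʸ (a *) (C A))))
            (⇒ʸ-monoʳ (a *) (idem A))

  monotone⇒hedgedMonotone :
    Extensive → Monotone → ClosedUnderHedgedShift → HedgedMonotone
  monotone⇒hedgedMonotone ext mono shift A B =
    from ≤S⇔⊆⇒ʸ (⊆-trans (mono A (s ⇒ʸ C B) A⊆s⇒CB) (shift (S 𝐋 Y A B) B))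
    where
    s = (S 𝐋 Y A B) *
    A⊆s⇒CB : A ⊆ʸ s ⇒ʸ C B
    A⊆s⇒CB = ⊆-trans (to ≤S⇔⊆⇒ʸ (*-≤ (S 𝐋 Y A B))) (⇒ʸ-monoʳ s (ext B))

theorem6 : (𝐋 : CompleteResiduatedLattice) (Y : Set) → Y →
    (_* : Carrier 𝐋 → Carrier 𝐋) → IsIdempotentHedge 𝐋 _* →
    (C : LSet 𝐋 Y → LSet 𝐋 Y) →
    IsLStarClosure 𝐋 Y _* C ⇔
      (IsL1Closure 𝐋 Y C ×
       ((a : Carrier 𝐋) (A : LSet 𝐋 Y) →
         _⊆_ 𝐋 Y (C (_⇒ˢ_ 𝐋 Y (a *) (C A))) (_⇒ˢ_ 𝐋 Y (a *) (C A))))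
theorem6 𝐋 Y _ _* hedge C = mk⇔
  (λ (ext , S*-mono , idem) →
     (ext , hedgedMonotone⇒monotone S*-mono , idem) ,
     hedgedMonotone⇒closedUnderHedgedShift S*-mono idem)
  (λ ((ext , mono , idem) , shift) →
     ext , monotone⇒hedgedMonotone ext mono shift , idem)
  where open ClosureOperators 𝐋 Y hedge C
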